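{- Let $H$ be a hypergraph, $u$ a vertex and $A$ a $u$-absorber in $H$, consisting of a Berge cycle $C$ of length $2t+1$ with vertex sequence $(u,v_1,\ldots,v_{2t})$ and Berge paths $P_1,\ldots,P_{t-1}$ as in the definition of an absorber. Then $A$ contains (a) a Berge path $P_u$ from $v_1$ to $v_{t+1}$ with $V^*(P_u)=V^*(C)\cup\bigcup_{i\in[t-1]}V^*(P_i)$, and (b) a Berge path $P$ from $v_1$ to $v_{t+1}$ with $V^*(P)=(V^*(C)\setminus\{u\})\cup\bigcup_{i\in[t-1]}V^*(P_i)$.
   Context: A Berge path is an alternating sequence $(v_1,e_1,v_2,\ldots,e_{k-1},v_k)$ of distinct vertices and distinct hyperedges with $v_i,v_{i+1}\in e_i$ for all $i\in[k-1]$; it connects its endpoints $v_1$ and $v_k$, and $V^*(P)=\{v_1,\ldots,v_k\}$, $E(P)=\{e_1,\ldots,e_{k-1}\}$. A Berge cycle is an alternating sequence $(w_1,f_1,\ldots,w_k,f_k)$ of distinct vertices and distinct hyperedges with $\{w_k,w_1\}\subseteq f_k$ and $\{w_i,w_{i+1}\}\subseteq f_i$ for $i\in[k-1]$; its vertex sequence is $(w_1,\ldots,w_k)$, $V^*(C)=\{w_1,\ldots,w_k\}$, and its length is $k$. A $u$-absorber in $H$ is a subgraph $A$ of $H$ such that: (i) $A$ contains a Berge cycle $C$ of length $2t+1$ (for some positive integer $t$) with vertex sequence $(u,v_1,\ldots,v_{2t})$; (ii) there are $t-1$ Berge paths $P_1,\ldots,P_{t-1}$ such that $P_i$ has endpoints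 $v_{i+1}$ and $v_{2t+1-i}$, and the vertices of the paths $P_i$ other than their endpoints are pairwise distinct across paths and do not lie in $V^*(C)$; (iii) the edge sets $E(C),E(P_1),\ldots,E(P_{t-1})$ are pairwise disjoint; (iv) $E(A)=E(C)\cup\bigcup_{i\in[t-1]}E(P_i)$. The vertices $v_1$ and $v_{t+1}$ are the main endpoints of $A$. -}

module Defs where

open import Data.Nat using (ℕ; zero; suc; _+_; _∸_; _<?_)
open import Data.Fin using (Fin; zero; suc; fromℕ; fromℕ<; inject₁; toℕ)
open import Data.Product using (Σ; ∃; _×_; _,_)
open import Data.Sum using (_⊎_)
open import Relation.Binary.PropositionalEquality using (_≡_; _≢_)
open import Relation.Nullary using (¬_; yes; no)
open import Function.Definitions using (Injective)

record Hypergraph : Set₁ where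
  field
    V   : Set
    E   : Set
    _∈ₑ_ : V → E → Set

module _ (H : Hypergraph) where
  open Hypergraph H

  record BergePath : Set where
    field
      k     : ℕ
      vert  : Fin (suc k) → V
      edge  : Fin k → E
      vert-inj : Injective _≡_ _≡_ vert
      edge-inj : Injective _≡_ _≡_ edge
      adj   : (i : Fin k) → (vert (inject₁ i) ∈ₑ edge i) × (vert (suc i) ∈ₑ edge i)

    start : V
    start = vert zero

    end : V
    end = vert (fromℕ k)

    InV : V → Set
    InV x = ∃ λ i → vert i ≡ x

    InE : E → Set
    InE e = ∃ λ i → edge i ≡ e

    Interior : V → Set
    Interior x = InV x × x ≢ start × x ≢ end

  -- Berge cycle of length (suc m): vertices w₀,…,w_m and edges f₀,…,f_m,
  -- {w_i,w_{i+1}} ⊆ f_i for i < m and {w_m,w₀} ⊆ f_m.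
  record BergeCycle (m : ℕ) : Set where
    field
      w     : Fin (suc m) → V
      f     : Fin (suc m) → E
      w-inj : Injective _≡_ _≡_ w
      f-inj : Injective _≡_ _≡_ f
      adj   : (i : Fin m) → (w (inject₁ i) ∈ₑ f (inject₁ i)) × (w (suc i) ∈ₑ f (inject₁ i))
      adj-last : (w (fromℕ m) ∈ₑ f (fromℕ m)) × (w zero ∈ₑ f (fromℕ m))

    InV : V → Set
    InV x = ∃ λ i → w i ≡ x

    InE : E → Set
    InE e = ∃ λ i → f i ≡ e

  -- Vertex at a natural-number position of a cycle (junk value w₀ out of range;
  -- only used at in-range positions below).
  at : ∀ {m} → BergeCycle m → ℕ → V
  at {m} C i with i <? suc m
  ... | yes p = BergeCycle.w C (fromℕ< p)
  ... | no  _ = BergeCycle.w C zero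

  -- u-absorber: cycle C of length 2t+1 with vertex sequence (u,v₁,…,v_{2t})
  -- (so v_i = w_i), and paths P_i (i ∈ [t-1], indexed by j = i-1 : Fin (t ∸ 1))
  -- with endpoints v_{i+1}, v_{2t+1-i}.
  record Absorber (u : V) : Set where
    field
      t      : ℕ
      t≥1    : Data.Nat._≤_ 1 t
      C      : BergeCycle (t + t)
      C-u    : BergeCycle.w C zero ≡ u
      P      : Fin (t ∸ 1) → BergePath
      -- (ii) endpoints of P_i are v_{i+1} and v_{2t+1-i}, where i = j+1
      P-ends : (j : Fin (t ∸ 1)) →
                 (BergePath.start (P j) ≡ at C (suc (suc (toℕ j))) ×
                  BergePath.end (P j) ≡ at C ((t + t) ∸ toℕ j))
               ⊎ (BergePath.start (P j) ≡ at C ((t + t) ∸ toℕ j) ×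
                  BergePath.end (P j) ≡ at C (suc (suc (toℕ j))))
      P-inner-disj : (j j′ : Fin (t ∸ 1)) → j ≢ j′ → (x : V) →
                 BergePath.Interior (P j) x → ¬ BergePath.Interior (P j′) x
      P-inner-C : (j : Fin (t ∸ 1)) → (x : V) →
                 BergePath.Interior (P j) x → ¬ BergeCycle.InV C x
      E-disj-C : (j : Fin (t ∸ 1)) → (e : E) →
                 BergePath.InE (P j) e → ¬ BergeCycle.InE C e
      E-disj-P : (j j′ : Fin (t ∸ 1)) → j ≢ j′ → (e : E) →
                 BergePath.InE (P j) e → ¬ BergePath.InE (P j′) e

    InEA : E → Set
    InEA e = BergeCycle.InE C e ⊎ ∃ λ j → BergePath.InE (P j) e

    InVAll : V → Set
    InVAll x = BergeCycle.InV C x ⊎ ∃ λ j → BergePath.InV (P j) x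

    v₁ : V
    v₁ = at C 1

    vt+1 : V
    vt+1 = at C (suc t)

  -- "A contains a Berge path Q from a to b": all edges of Q are edges of A.
  ContainedIn : {u : V} → Absorber u → BergePath → Set
  ContainedIn A Q = (e : E) → BergePath.InE Q e → Absorber.InEA A e

-- The cycle C and the paths P_i form a ladder. Its two sides are v₁, v₂, …, v_{t+1} and
-- u, v_{2t}, v_{2t-1}, …, v_{t+1}, meeting at the top v_{t+1}; consecutive vertices of a side are
-- joined by edges of C (rails), and the two side vertices of level i are joined by a rung: the
-- edge of C through u and v₁ for i = 0, the path P_i for 1 ≤ i ≤ t-1. Climbing a rail, crossing
-- the next rung, climbing the rail on the other side, and so on, uses every higher rung exactly
-- once and ends at v_{t+1}; the disjointness conditions of the absorber make this a Berge path.
-- Starting at v₁ gives the path avoiding u; crossing rung 0 to u first gives the path through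
-- all of A.

module Submission where

open import Data.Bool using (Bool; true; false; not)
open import Data.Fin using (Fin; zero; suc; fromℕ; fromℕ<; inject₁; toℕ)
open import Data.Fin.Properties using (fromℕ<-toℕ; toℕ-fromℕ<; toℕ<n; toℕ-inject₁; toℕ-fromℕ; toℕ-injective)
import Data.Fin.Properties as Finₚ
open import Data.Nat using (ℕ; zero; suc; _+_; _∸_; _≤_; _<_; _<?_; _≤?_; _≟_; z≤n; s≤s)
open import Data.Nat.Properties
  using ( ≤-refl; ≤-reflexive; ≤-trans; ≤-pred; <⇒≤; <⇒≢; <⇒≱; ≰⇒>; ≤∧≢⇒<; <-≤-trans; <-irrefl; <-trans
        ; n<1+n; n≤1+n; m≤n⇒m≤1+n; m≤m+n; m≤n+m; m≤n⇒m<n∨m≡n; suc-injective; +-suc; +-identityʳ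
        ; +-∸-assoc; m+n∸m≡n; m+n∸n≡m; m∸n≤m; m∸[m∸n]≡n; ∸-monoʳ-≤; ∸-cancelˡ-≡ )
open import Data.Product using (Σ; ∃; ∃₂; _×_; _,_; proj₁; proj₂; swap)
open import Data.Sum using (_⊎_; inj₁; inj₂)
import Data.Sum as Sum
open import Data.Unit using (⊤; tt)
open import Function.Base using (_∘_)
open import Function.Bundles using (_⇔_; mk⇔)
open import Function.Definitions using (Injective)
open import Level using (0ℓ)
open import Relation.Binary.PropositionalEquality
  using (_≡_; _≢_; refl; sym; trans; cong; subst; subst₂; module ≡-Reasoning)
open import Relation.Nullary using (¬_; yes; no; contradiction)
open import Relation.Unary using (Pred; _∈_; _∉_; _⊆_; _≐_; _∪_; _∩_; ｛_｝; ∅)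

open import Defs

Image : {A B : Set} → (A → B) → Pred B 0ℓ
Image f y = ∃ λ x → f x ≡ y

module _ {A : Set} {m : ℕ} (f : Fin (suc m) → A) where

  -- Out-of-range positions give f zero, exactly as Defs.at does.
  indexℕ : ℕ → A
  indexℕ n with n <? suc m
  ... | yes n<1+m = f (fromℕ< n<1+m)
  ... | no  _     = f zero

  indexℕ-toℕ : (i : Fin (suc m)) → indexℕ (toℕ i) ≡ f i
  indexℕ-toℕ i with toℕ i <? suc m
  ... | yes i<1+m = cong f (fromℕ<-toℕ i i<1+m)
  ... | no  i≮1+m = contradiction (toℕ<n i) i≮1+m

  indexℕ-≡ : ∀ {i n} → toℕ i ≡ n → indexℕ n ≡ f i
  indexℕ-≡ refl = indexℕ-toℕ _

  indexℕ-fromℕ< : ∀ {n} (n<1+m : n < suc m) → indexℕ n ≡ f (fromℕ< n<1+m)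
  indexℕ-fromℕ< n<1+m = indexℕ-≡ (toℕ-fromℕ< n<1+m)

  indexℕ-injective : Injective _≡_ _≡_ f → ∀ {n n′} → n ≤ m → n′ ≤ m →
                     indexℕ n ≡ indexℕ n′ → n ≡ n′
  indexℕ-injective f-inj {n} {n′} n≤m n′≤m eq = begin
    n                        ≡⟨ toℕ-fromℕ< (s≤s n≤m) ⟨
    toℕ (fromℕ< (s≤s n≤m))   ≡⟨ cong toℕ (f-inj (begin
      f (fromℕ< (s≤s n≤m))     ≡⟨ indexℕ-fromℕ< (s≤s n≤m) ⟨
      indexℕ n                 ≡⟨ eq ⟩
      indexℕ n′                ≡⟨ indexℕ-fromℕ< (s≤s n′≤m) ⟩
      f (fromℕ< (s≤s n′≤m))    ∎)) ⟩
    toℕ (fromℕ< (s≤s n′≤m))  ≡⟨ toℕ-fromℕ< (s≤s n′≤m) ⟩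
    n′                       ∎
    where open ≡-Reasoning

  indexℕ∈image : ∀ {n} → n ≤ m → indexℕ n ∈ Image f
  indexℕ∈image n≤m = fromℕ< (s≤s n≤m) , sym (indexℕ-fromℕ< (s≤s n≤m))

  image⇒indexℕ : ∀ {x} → x ∈ Image f → ∃ λ n → n ≤ m × indexℕ n ≡ x
  image⇒indexℕ (i , fi≡x) = toℕ i , ≤-pred (toℕ<n i) , trans (indexℕ-toℕ i) fi≡x

module _ (H : Hypergraph) where
  open Hypergraph H

  private variable
    a b c a′ b′ : V
    e : E
    Vs Vs′ : Pred V 0ℓ
    Es Es′ : Pred E 0ℓ

  data Walk : V → V → Set where
    [_]  : ∀ a → Walk a a
    step : ∀ a e → a ∈ₑ e → b ∈ₑ e → Walk b c → Walk a c

  vertices : Walk a b → Pred V 0ℓ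
  vertices [ a ]              = ｛ a ｝
  vertices (step a _ _ _ W)   = ｛ a ｝ ∪ vertices W

  edges : Walk a b → Pred E 0ℓ
  edges [ _ ]                 = ∅
  edges (step _ e _ _ W)      = ｛ e ｝ ∪ edges W

  IsPath : Walk a b → Set
  IsPath [ _ ]                = ⊤
  IsPath (step a e _ _ W)     = a ∉ vertices W × e ∉ edges W × IsPath W

  start∈vertices : (W : Walk a b) → a ∈ vertices W
  start∈vertices [ _ ]            = refl
  start∈vertices (step _ _ _ _ _) = inj₁ refl

  end∈vertices : (W : Walk a b) → b ∈ vertices W
  end∈vertices [ _ ]            = refl
  end∈vertices (step _ _ _ _ W) = inj₂ (end∈vertices W)

  infixr 5 _++_
  _++_ : Walk a b → Walk b c → Walk a c
  [ _ ]            ++ W′ = W′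
  step a e p q W   ++ W′ = step a e p q (W ++ W′)

  vertices-++⁻ : (W : Walk a b) (W′ : Walk b c) → vertices (W ++ W′) ⊆ vertices W ∪ vertices W′
  vertices-++⁻ [ _ ]            W′ x∈         = inj₂ x∈
  vertices-++⁻ (step _ _ _ _ W) W′ (inj₁ a≡x) = inj₁ (inj₁ a≡x)
  vertices-++⁻ (step _ _ _ _ W) W′ (inj₂ x∈) with vertices-++⁻ W W′ x∈
  ... | inj₁ x∈W  = inj₁ (inj₂ x∈W)
  ... | inj₂ x∈W′ = inj₂ x∈W′

  vertices-++⁺ : (W : Walk a b) (W′ : Walk b c) → vertices W ∪ vertices W′ ⊆ vertices (W ++ W′)
  vertices-++⁺ [ _ ]            W′ (inj₁ refl)     = start∈vertices W′
  vertices-++⁺ [ _ ]            W′ (inj₂ x∈W′)     = x∈W′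
  vertices-++⁺ (step _ _ _ _ W) W′ (inj₁ (inj₁ p)) = inj₁ p
  vertices-++⁺ (step _ _ _ _ W) W′ (inj₁ (inj₂ x∈W)) = inj₂ (vertices-++⁺ W W′ (inj₁ x∈W))
  vertices-++⁺ (step _ _ _ _ W) W′ (inj₂ x∈W′)     = inj₂ (vertices-++⁺ W W′ (inj₂ x∈W′))

  edges-++⁻ : (W : Walk a b) (W′ : Walk b c) → edges (W ++ W′) ⊆ edges W ∪ edges W′
  edges-++⁻ [ _ ]            W′ e∈          = inj₂ e∈
  edges-++⁻ (step _ _ _ _ W) W′ (inj₁ refl) = inj₁ (inj₁ refl)
  edges-++⁻ (step _ _ _ _ W) W′ (inj₂ e∈) with edges-++⁻ W W′ e∈
  ... | inj₁ e∈W  = inj₁ (inj₂ e∈W)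
  ... | inj₂ e∈W′ = inj₂ e∈W′

  ++-isPath : (W : Walk a b) (W′ : Walk b c) → IsPath W → IsPath W′ →
              vertices W ∩ vertices W′ ⊆ ｛ b ｝ → edges W ∩ edges W′ ⊆ ∅ → IsPath (W ++ W′)
  ++-isPath [ _ ] W′ _ W′-path _ _ = W′-path
  ++-isPath (step a e _ _ W) W′ (a∉W , e∉W , W-path) W′-path meet disjoint =
      a∉W++W′
    , e∉W++W′
    , ++-isPath W W′ W-path W′-path (λ (x∈W , x∈W′) → meet (inj₂ x∈W , x∈W′))
                                    (λ (e∈W , e∈W′) → disjoint (inj₂ e∈W , e∈W′))
    where
    a∉W++W′ : a ∉ vertices (W ++ W′)
    a∉W++W′ a∈ with vertices-++⁻ W W′ a∈
    ... | inj₁ a∈W  = a∉W a∈W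
    ... | inj₂ a∈W′ = a∉W (subst (vertices W) (meet (inj₁ refl , a∈W′)) (end∈vertices W))
    e∉W++W′ : e ∉ edges (W ++ W′)
    e∉W++W′ e∈ with edges-++⁻ W W′ e∈
    ... | inj₁ e∈W  = e∉W e∈W
    ... | inj₂ e∈W′ = disjoint (inj₁ refl , e∈W′)

  record PathThrough (a b : V) (Vs : Pred V 0ℓ) (Es : Pred E 0ℓ) : Set where
    field
      walk      : Walk a b
      isPath    : IsPath walk
      vertices≐ : vertices walk ≐ Vs
      edges⊆    : edges walk ⊆ Es

  open PathThrough

  trivialPath : ∀ a → PathThrough a a ｛ a ｝ ∅
  trivialPath a = record { walk = [ a ] ; isPath = tt ; vertices≐ = (λ x → x) , (λ x → x) ; edges⊆ = λ () }

  edgePath : a ≢ b → a ∈ₑ e → b ∈ₑ e → PathThrough a b (｛ a ｝ ∪ ｛ b ｝) ｛ e ｝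
  edgePath {a} {b} {e} a≢b a∈e b∈e = record
    { walk      = step a e a∈e b∈e [ b ]
    ; isPath    = (λ b≡a → a≢b (sym b≡a)) , (λ ()) , tt
    ; vertices≐ = (λ x → x) , (λ x → x)
    ; edges⊆    = λ { (inj₁ e≡) → e≡ } }

  reshape : Vs ≐ Vs′ → Es ⊆ Es′ → PathThrough a b Vs Es → PathThrough a b Vs′ Es′
  reshape (Vs⊆ , ⊇Vs) Es⊆ P = record
    { walk      = walk P
    ; isPath    = isPath P
    ; vertices≐ = (λ x∈ → Vs⊆ (proj₁ (vertices≐ P) x∈)) , (λ x∈ → proj₂ (vertices≐ P) (⊇Vs x∈))
    ; edges⊆    = λ e∈ → Es⊆ (edges⊆ P e∈) }

  retarget : a ≡ a′ → b ≡ b′ → PathThrough a b Vs Es → PathThrough a′ b′ Vs Es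
  retarget refl refl P = P

  join : PathThrough a b Vs Es → PathThrough b c Vs′ Es′ →
         Vs ∩ Vs′ ⊆ ｛ b ｝ → Es ∩ Es′ ⊆ ∅ → PathThrough a c (Vs ∪ Vs′) (Es ∪ Es′)
  join P Q meet disjoint = record
    { walk      = walk P ++ walk Q
    ; isPath    = ++-isPath (walk P) (walk Q) (isPath P) (isPath Q)
                    (λ (x∈P , x∈Q) → meet (proj₁ (vertices≐ P) x∈P , proj₁ (vertices≐ Q) x∈Q))
                    (λ (e∈P , e∈Q) → disjoint (edges⊆ P e∈P , edges⊆ Q e∈Q))
    ; vertices≐ = (Sum.map (proj₁ (vertices≐ P)) (proj₁ (vertices≐ Q)) ∘ vertices-++⁻ (walk P) (walk Q))
                , (vertices-++⁺ (walk P) (walk Q) ∘ Sum.map (proj₂ (vertices≐ P)) (proj₂ (vertices≐ Q)))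
    ; edges⊆    = λ e∈ → Sum.map (edges⊆ P) (edges⊆ Q) (edges-++⁻ (walk P) (walk Q) e∈) }

  reverseWalk : (W : Walk a b) → IsPath W → PathThrough b a (vertices W) (edges W)
  reverseWalk [ a ] _ = trivialPath a
  reverseWalk {a} (step a e a∈e b∈e W) (a∉W , e∉W , W-path) =
    reshape (swap-vertices , swap-vertices⁻¹) swap-edges
      (join (reverseWalk W W-path) (edgePath b≢a b∈e a∈e) meet disjoint)
    where
    b≢a : _ ≢ a
    b≢a b≡a = a∉W (subst (vertices W) b≡a (start∈vertices W))
    meet : vertices W ∩ (｛ _ ｝ ∪ ｛ a ｝) ⊆ ｛ _ ｝
    meet (_   , inj₁ b≡x) = b≡x
    meet (x∈W , inj₂ refl) = contradiction x∈W a∉W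
    disjoint : edges W ∩ ｛ e ｝ ⊆ ∅
    disjoint (e∈W , refl) = e∉W e∈W
    swap-vertices : vertices W ∪ (｛ _ ｝ ∪ ｛ a ｝) ⊆ ｛ a ｝ ∪ vertices W
    swap-vertices (inj₁ x∈W)         = inj₂ x∈W
    swap-vertices (inj₂ (inj₁ refl)) = inj₂ (start∈vertices W)
    swap-vertices (inj₂ (inj₂ a≡x))  = inj₁ a≡x
    swap-vertices⁻¹ : ｛ a ｝ ∪ vertices W ⊆ vertices W ∪ (｛ _ ｝ ∪ ｛ a ｝)
    swap-vertices⁻¹ (inj₁ a≡x) = inj₂ (inj₂ a≡x)
    swap-vertices⁻¹ (inj₂ x∈W) = inj₁ x∈W
    swap-edges : edges W ∪ ｛ e ｝ ⊆ ｛ e ｝ ∪ edges W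
    swap-edges (inj₁ e∈W) = inj₂ e∈W
    swap-edges (inj₂ e≡)  = inj₁ e≡

  reverse : PathThrough a b Vs Es → PathThrough b a Vs Es
  reverse P = reshape (vertices≐ P) (edges⊆ P) (reverseWalk (walk P) (isPath P))

  walkAlong : ∀ k (v : Fin (suc k) → V) (ε : Fin k → E) →
              (∀ i → v (inject₁ i) ∈ₑ ε i × v (suc i) ∈ₑ ε i) → Walk (v zero) (v (fromℕ k))
  walkAlong zero    v ε adj = [ v zero ]
  walkAlong (suc k) v ε adj =
    step (v zero) (ε zero) (proj₁ (adj zero)) (proj₂ (adj zero)) (walkAlong k (v ∘ suc) (ε ∘ suc) (adj ∘ suc))

  vertices-walkAlong⁻ : ∀ k v ε adj → vertices (walkAlong k v ε adj) ⊆ Image v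
  vertices-walkAlong⁻ zero    v ε adj v0≡x        = zero , v0≡x
  vertices-walkAlong⁻ (suc k) v ε adj (inj₁ v0≡x) = zero , v0≡x
  vertices-walkAlong⁻ (suc k) v ε adj (inj₂ x∈) with vertices-walkAlong⁻ k (v ∘ suc) (ε ∘ suc) (adj ∘ suc) x∈
  ... | i , vi≡x = suc i , vi≡x

  vertices-walkAlong⁺ : ∀ k v ε adj → Image v ⊆ vertices (walkAlong k v ε adj)
  vertices-walkAlong⁺ zero    v ε adj (zero  , refl) = refl
  vertices-walkAlong⁺ (suc k) v ε adj (zero  , refl) = inj₁ refl
  vertices-walkAlong⁺ (suc k) v ε adj (suc i , refl) =
    inj₂ (vertices-walkAlong⁺ k (v ∘ suc) (ε ∘ suc) (adj ∘ suc) (i , refl))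

  edges-walkAlong : ∀ k v ε adj → edges (walkAlong k v ε adj) ⊆ Image ε
  edges-walkAlong (suc k) v ε adj (inj₁ e≡) = zero , e≡
  edges-walkAlong (suc k) v ε adj (inj₂ e∈) with edges-walkAlong k (v ∘ suc) (ε ∘ suc) (adj ∘ suc) e∈
  ... | i , εi≡e = suc i , εi≡e

  walkAlong-isPath : ∀ k v ε adj → Injective _≡_ _≡_ v → Injective _≡_ _≡_ ε → IsPath (walkAlong k v ε adj)
  walkAlong-isPath zero    v ε adj v-inj ε-inj = tt
  walkAlong-isPath (suc k) v ε adj v-inj ε-inj =
      (λ v0∈ → let (i , vi≡v0) = vertices-walkAlong⁻ k _ _ _ v0∈ in Finₚ.0≢1+n (v-inj (sym vi≡v0)))
    , (λ ε0∈ → let (i , εi≡ε0) = edges-walkAlong k _ _ _ ε0∈ in Finₚ.0≢1+n (ε-inj (sym εi≡ε0)))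
    , walkAlong-isPath k _ _ _ (Finₚ.suc-injective ∘ v-inj) (Finₚ.suc-injective ∘ ε-inj)

  fromBergePath : (Q : BergePath H) →
                  PathThrough (BergePath.start Q) (BergePath.end Q) (BergePath.InV Q) (BergePath.InE Q)
  fromBergePath Q = record
    { walk      = walkAlong k vert edge adj
    ; isPath    = walkAlong-isPath k vert edge adj vert-inj edge-inj
    ; vertices≐ = vertices-walkAlong⁻ k vert edge adj , vertices-walkAlong⁺ k vert edge adj
    ; edges⊆    = edges-walkAlong k vert edge adj }
    where open BergePath Q

  length : Walk a b → ℕ
  length [ _ ]            = zero
  length (step _ _ _ _ W) = suc (length W)

  vertexAt : (W : Walk a b) → Fin (suc (length W)) → V
  vertexAt [ a ]            _       = a
  vertexAt (step a _ _ _ W) zero    = a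
  vertexAt (step _ _ _ _ W) (suc i) = vertexAt W i

  edgeAt : (W : Walk a b) → Fin (length W) → E
  edgeAt (step _ e _ _ W) zero    = e
  edgeAt (step _ _ _ _ W) (suc i) = edgeAt W i

  vertexAt-zero : (W : Walk a b) → vertexAt W zero ≡ a
  vertexAt-zero [ _ ]            = refl
  vertexAt-zero (step _ _ _ _ _) = refl

  vertexAt-last : (W : Walk a b) → vertexAt W (fromℕ (length W)) ≡ b
  vertexAt-last [ _ ]            = refl
  vertexAt-last (step _ _ _ _ W) = vertexAt-last W

  vertexAt∈vertices : (W : Walk a b) (i : Fin (suc (length W))) → vertexAt W i ∈ vertices W
  vertexAt∈vertices [ _ ]            _       = refl
  vertexAt∈vertices (step _ _ _ _ W) zero    = inj₁ refl
  vertexAt∈vertices (step _ _ _ _ W) (suc i) = inj₂ (vertexAt∈vertices W i)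

  vertices⊆image : (W : Walk a b) → vertices W ⊆ Image (vertexAt W)
  vertices⊆image [ _ ]            a≡x        = zero , a≡x
  vertices⊆image (step _ _ _ _ W) (inj₁ a≡x) = zero , a≡x
  vertices⊆image (step _ _ _ _ W) (inj₂ x∈W) with vertices⊆image W x∈W
  ... | i , vi≡x = suc i , vi≡x

  edgeAt∈edges : (W : Walk a b) (i : Fin (length W)) → edgeAt W i ∈ edges W
  edgeAt∈edges (step _ _ _ _ W) zero    = inj₁ refl
  edgeAt∈edges (step _ _ _ _ W) (suc i) = inj₂ (edgeAt∈edges W i)

  vertexAt-injective : (W : Walk a b) → IsPath W → Injective _≡_ _≡_ (vertexAt W)
  vertexAt-injective [ _ ]            _                 {zero}  {zero}  _  = refl
  vertexAt-injective (step _ _ _ _ W) _                 {zero}  {zero}  _  = refl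
  vertexAt-injective (step _ _ _ _ W) (a∉W , _ , _)     {zero}  {suc j} eq =
    contradiction (subst (vertices W) (sym eq) (vertexAt∈vertices W j)) a∉W
  vertexAt-injective (step _ _ _ _ W) (a∉W , _ , _)     {suc i} {zero}  eq =
    contradiction (subst (vertices W) eq (vertexAt∈vertices W i)) a∉W
  vertexAt-injective (step _ _ _ _ W) (_ , _ , W-path)  {suc i} {suc j} eq = cong suc (vertexAt-injective W W-path eq)

  edgeAt-injective : (W : Walk a b) → IsPath W → Injective _≡_ _≡_ (edgeAt W)
  edgeAt-injective (step _ _ _ _ W) _                {zero}  {zero}  _  = refl
  edgeAt-injective (step _ _ _ _ W) (_ , e∉W , _)    {zero}  {suc j} eq =
    contradiction (subst (edges W) (sym eq) (edgeAt∈edges W j)) e∉W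
  edgeAt-injective (step _ _ _ _ W) (_ , e∉W , _)    {suc i} {zero}  eq =
    contradiction (subst (edges W) eq (edgeAt∈edges W i)) e∉W
  edgeAt-injective (step _ _ _ _ W) (_ , _ , W-path) {suc i} {suc j} eq = cong suc (edgeAt-injective W W-path eq)

  edgeAt-adjacent : (W : Walk a b) (i : Fin (length W)) →
                    vertexAt W (inject₁ i) ∈ₑ edgeAt W i × vertexAt W (suc i) ∈ₑ edgeAt W i
  edgeAt-adjacent (step _ e a∈e b∈e W) zero    = a∈e , subst (_∈ₑ e) (sym (vertexAt-zero W)) b∈e
  edgeAt-adjacent (step _ _ _   _   W) (suc i) = edgeAt-adjacent W i

  BergePathThrough : V → V → Pred V 0ℓ → Pred E 0ℓ → Set
  BergePathThrough a b Vs Es = Σ (BergePath H) λ Q →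
      ((e : E) → BergePath.InE Q e → Es e)
    × BergePath.start Q ≡ a
    × BergePath.end Q ≡ b
    × ((x : V) → BergePath.InV Q x ⇔ Vs x)

  toBergePath : PathThrough a b Vs Es → BergePathThrough a b Vs Es
  toBergePath P = Q
                , (λ { e (i , refl) → edges⊆ P (edgeAt∈edges (walk P) i) })
                , vertexAt-zero (walk P)
                , vertexAt-last (walk P)
                , λ x → mk⇔ (λ { (i , refl) → proj₁ (vertices≐ P) (vertexAt∈vertices (walk P) i) })
                            (λ x∈ → vertices⊆image (walk P) (proj₂ (vertices≐ P) x∈))
    where
    Q : BergePath H
    Q = record
      { k        = length (walk P)
      ; vert     = vertexAt (walk P)
      ; edge     = edgeAt (walk P)
      ; vert-inj = vertexAt-injective (walk P) (isPath P)
      ; edge-inj = edgeAt-injective (walk P) (isPath P)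
      ; adj      = edgeAt-adjacent (walk P) }

  endpoint⊎interior : (Q : BergePath H) → ∀ {x} → BergePath.InV Q x →
                      x ≡ BergePath.start Q ⊎ x ≡ BergePath.end Q ⊎ BergePath.Interior Q x
  endpoint⊎interior Q (i , refl) with i Finₚ.≟ zero | i Finₚ.≟ fromℕ (BergePath.k Q)
  ... | yes refl | _        = inj₁ refl
  ... | no  _    | yes refl = inj₂ (inj₁ refl)
  ... | no  i≢0  | no  i≢k  = inj₂ (inj₂ ((i , refl) , i≢0 ∘ BergePath.vert-inj Q , i≢k ∘ BergePath.vert-inj Q))

  module _ {m : ℕ} (C : BergeCycle H m) where
    open BergeCycle C

    at≡indexℕ : ∀ n → at H C n ≡ indexℕ w n
    at≡indexℕ n with n <? suc m
    ... | yes _ = refl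
    ... | no  _ = refl

    atₑ : ℕ → E
    atₑ = indexℕ f

    at-≡ : ∀ {i n} → toℕ i ≡ n → at H C n ≡ w i
    at-≡ {n = n} eq = trans (at≡indexℕ n) (indexℕ-≡ w eq)

    atₑ-adjacent : ∀ {n} → n < m → at H C n ∈ₑ atₑ n × at H C (suc n) ∈ₑ atₑ n
    atₑ-adjacent n<m =
        subst₂ _∈ₑ_ (sym (at-≡ inject₁≡)) (sym (indexℕ-≡ f inject₁≡)) (proj₁ (adj i))
      , subst₂ _∈ₑ_ (sym (at-≡ (cong suc (toℕ-fromℕ< n<m)))) (sym (indexℕ-≡ f inject₁≡)) (proj₂ (adj i))
      where
      i = fromℕ< n<m
      inject₁≡ = trans (toℕ-inject₁ i) (toℕ-fromℕ< n<m)

    atₑ-adjacent-last : at H C m ∈ₑ atₑ m × at H C 0 ∈ₑ atₑ m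
    atₑ-adjacent-last =
        subst₂ _∈ₑ_ (sym (at-≡ (toℕ-fromℕ m))) (sym (indexℕ-≡ f (toℕ-fromℕ m))) (proj₁ adj-last)
      , subst₂ _∈ₑ_ (sym (at-≡ refl)) (sym (indexℕ-≡ f (toℕ-fromℕ m))) (proj₂ adj-last)

    at-injective : ∀ {n n′} → n ≤ m → n′ ≤ m → at H C n ≡ at H C n′ → n ≡ n′
    at-injective {n} {n′} n≤m n′≤m eq =
      indexℕ-injective w w-inj n≤m n′≤m (trans (sym (at≡indexℕ n)) (trans eq (at≡indexℕ n′)))

    at∈cycle : ∀ {n} → n ≤ m → InV (at H C n)
    at∈cycle {n} n≤m = let (i , eq) = indexℕ∈image w n≤m in i , trans eq (sym (at≡indexℕ n))

    cycle⇒at : ∀ {x} → InV x → ∃ λ n → n ≤ m × at H C n ≡ x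
    cycle⇒at x∈ = let (n , n≤m , eq) = image⇒indexℕ w x∈ in n , n≤m , trans (at≡indexℕ n) eq

    atₑ-injective : ∀ {n n′} → n ≤ m → n′ ≤ m → atₑ n ≡ atₑ n′ → n ≡ n′
    atₑ-injective = indexℕ-injective f f-inj

    atₑ∈cycle : ∀ {n} → n ≤ m → InE (atₑ n)
    atₑ∈cycle = indexℕ∈image f

  record Ladder (s : ℕ) : Set₁ where
    field
      side           : Bool → ℕ → V
      top            : V
      side-top       : ∀ σ → side σ (suc s) ≡ top
      rail           : Bool → ℕ → E
      rail-adjacent  : ∀ σ {ℓ} → ℓ ≤ s → side σ ℓ ∈ₑ rail σ ℓ × side σ (suc ℓ) ∈ₑ rail σ ℓ
      RungV          : ℕ → Pred V 0ℓ
      RungE          : ℕ → Pred E 0ℓ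
      rung           : ∀ {ℓ} → ℓ ≤ s → PathThrough (side true ℓ) (side false ℓ) (RungV ℓ) (RungE ℓ)
      rungV-disjoint : ∀ {ℓ ℓ′} → ℓ ≤ s → ℓ′ ≤ s → ℓ ≢ ℓ′ → RungV ℓ ∩ RungV ℓ′ ⊆ ∅
      top∉rung       : ∀ {ℓ} → ℓ ≤ s → top ∉ RungV ℓ
      rail-injective : ∀ {σ σ′ ℓ ℓ′} → ℓ ≤ s → ℓ′ ≤ s → rail σ ℓ ≡ rail σ′ ℓ′ → ℓ ≡ ℓ′
      rail∉rung      : ∀ σ {ℓ ℓ′} → ℓ ≤ s → ℓ′ ≤ s → rail σ ℓ ∉ RungE ℓ′
      rungE-disjoint : ∀ {ℓ ℓ′} → ℓ ≤ s → ℓ′ ≤ s → ℓ ≢ ℓ′ → RungE ℓ ∩ RungE ℓ′ ⊆ ∅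

  module _ {s : ℕ} (L : Ladder s) where
    open Ladder L

    rungFrom : ∀ σ {ℓ} → ℓ ≤ s → PathThrough (side σ ℓ) (side (not σ) ℓ) (RungV ℓ) (RungE ℓ)
    rungFrom true  ℓ≤s = rung ℓ≤s
    rungFrom false ℓ≤s = reverse (rung ℓ≤s)

    side∈rung : ∀ σ {ℓ} → ℓ ≤ s → side σ ℓ ∈ RungV ℓ
    side∈rung σ ℓ≤s = proj₁ (vertices≐ (rungFrom σ ℓ≤s)) (start∈vertices (walk (rungFrom σ ℓ≤s)))

    RungsAbove : ℕ → Pred V 0ℓ
    RungsAbove ℓ x = ∃ λ ℓ′ → ℓ < ℓ′ × ℓ′ ≤ s × x ∈ RungV ℓ′

    RungEdgesAbove : ℕ → Pred E 0ℓ
    RungEdgesAbove ℓ e = ∃ λ ℓ′ → ℓ < ℓ′ × ℓ′ ≤ s × e ∈ RungE ℓ′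

    RailsFrom : ℕ → Pred E 0ℓ
    RailsFrom ℓ e = ∃₂ λ σ ℓ′ → ℓ ≤ ℓ′ × ℓ′ ≤ s × rail σ ℓ′ ≡ e

    Reachable : ℕ → Bool → Pred V 0ℓ
    Reachable ℓ σ = ｛ side σ ℓ ｝ ∪ ｛ top ｝ ∪ RungsAbove ℓ

    UsedEdges : ℕ → Pred E 0ℓ
    UsedEdges ℓ = RailsFrom ℓ ∪ RungEdgesAbove ℓ

    rung∩rungsAbove : ∀ {ℓ} → ℓ ≤ s → RungV ℓ ∩ RungsAbove ℓ ⊆ ∅
    rung∩rungsAbove ℓ≤s (x∈ , ℓ′ , ℓ<ℓ′ , ℓ′≤s , x∈′) =
      rungV-disjoint ℓ≤s ℓ′≤s (<⇒≢ ℓ<ℓ′) (x∈ , x∈′)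

    rung∩reachable : ∀ σ {ℓ} → ℓ ≤ s → RungV ℓ ∩ Reachable ℓ σ ⊆ ｛ side σ ℓ ｝
    rung∩reachable σ ℓ≤s (_  , inj₁ side≡x)        = side≡x
    rung∩reachable σ ℓ≤s (x∈ , inj₂ (inj₁ refl))   = contradiction x∈ (top∉rung ℓ≤s)
    rung∩reachable σ ℓ≤s (x∈ , inj₂ (inj₂ above))  = contradiction (x∈ , above) (rung∩rungsAbove ℓ≤s)

    rung∩usedEdges : ∀ {ℓ} → ℓ ≤ s → RungE ℓ ∩ UsedEdges ℓ ⊆ ∅
    rung∩usedEdges ℓ≤s (e∈ , inj₁ (σ , ℓ′ , _ , ℓ′≤s , refl)) = rail∉rung σ ℓ′≤s ℓ≤s e∈
    rung∩usedEdges ℓ≤s (e∈ , inj₂ (ℓ′ , ℓ<ℓ′ , ℓ′≤s , e∈′))   =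
      rungE-disjoint ℓ≤s ℓ′≤s (<⇒≢ ℓ<ℓ′) (e∈ , e∈′)

    rungsAbove-step : ∀ {ℓ} → ℓ < s → RungsAbove ℓ ⊆ RungV (suc ℓ) ∪ RungsAbove (suc ℓ)
    rungsAbove-step {ℓ} ℓ<s (ℓ′ , ℓ<ℓ′ , ℓ′≤s , x∈) with suc ℓ ≟ ℓ′
    ... | yes refl = inj₁ x∈
    ... | no  ℓ+1≢ℓ′ = inj₂ (ℓ′ , ≤∧≢⇒< ℓ<ℓ′ ℓ+1≢ℓ′ , ℓ′≤s , x∈)

    rungsAbove-last : RungsAbove s ⊆ ∅
    rungsAbove-last (ℓ′ , s<ℓ′ , ℓ′≤s , _) = <-irrefl refl (<-≤-trans s<ℓ′ ℓ′≤s)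

    beyondRail⊆ : ∀ σ {ℓ} → ℓ < s → RungV (suc ℓ) ∪ Reachable (suc ℓ) σ ⊆ ｛ top ｝ ∪ RungsAbove ℓ
    beyondRail⊆ σ ℓ<s (inj₁ x∈)                  = inj₂ (_ , ≤-refl , ℓ<s , x∈)
    beyondRail⊆ σ ℓ<s (inj₂ (inj₁ refl))         = inj₂ (_ , ≤-refl , ℓ<s , side∈rung σ ℓ<s)
    beyondRail⊆ σ ℓ<s (inj₂ (inj₂ (inj₁ top≡x))) = inj₁ top≡x
    beyondRail⊆ σ ℓ<s (inj₂ (inj₂ (inj₂ (ℓ′ , ℓ+1<ℓ′ , ℓ′≤s , x∈)))) =
      inj₂ (ℓ′ , <-trans (n<1+n _) ℓ+1<ℓ′ , ℓ′≤s , x∈)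

    side∉beyond : ∀ σ {ℓ} → ℓ ≤ s → side σ ℓ ∉ ｛ top ｝ ∪ RungsAbove ℓ
    side∉beyond σ ℓ≤s (inj₁ top≡side) = top∉rung ℓ≤s (subst (RungV _) (sym top≡side) (side∈rung σ ℓ≤s))
    side∉beyond σ ℓ≤s (inj₂ above)    = rung∩rungsAbove ℓ≤s (side∈rung σ ℓ≤s , above)

    RailStep : Bool → ℕ → Pred V 0ℓ
    RailStep σ ℓ = ｛ side σ ℓ ｝ ∪ ｛ side σ (suc ℓ) ｝

    AfterRail : Bool → ℕ → Pred V 0ℓ
    AfterRail σ ℓ = RungV (suc ℓ) ∪ Reachable (suc ℓ) (not σ)

    reachable-unfold : ∀ σ {ℓ} → ℓ < s → RailStep σ ℓ ∪ AfterRail σ ℓ ≐ Reachable ℓ σ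
    reachable-unfold σ ℓ<s = ⊆reachable , reachable⊆
      where
      ⊆reachable : RailStep σ _ ∪ AfterRail σ _ ⊆ Reachable _ σ
      ⊆reachable (inj₁ (inj₁ eq))   = inj₁ eq
      ⊆reachable (inj₁ (inj₂ refl)) = inj₂ (inj₂ (_ , ≤-refl , ℓ<s , side∈rung σ ℓ<s))
      ⊆reachable (inj₂ x∈)          = inj₂ (beyondRail⊆ (not σ) ℓ<s x∈)
      reachable⊆ : Reachable _ σ ⊆ RailStep σ _ ∪ AfterRail σ _
      reachable⊆ (inj₁ eq)           = inj₁ (inj₁ eq)
      reachable⊆ (inj₂ (inj₁ eq))    = inj₂ (inj₂ (inj₂ (inj₁ eq)))
      reachable⊆ (inj₂ (inj₂ above)) = inj₂ (Sum.map₂ (inj₂ ∘ inj₂) (rungsAbove-step ℓ<s above))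

    railStep∩afterRail : ∀ σ {ℓ} → ℓ < s → RailStep σ ℓ ∩ AfterRail σ ℓ ⊆ ｛ side σ (suc ℓ) ｝
    railStep∩afterRail σ ℓ<s (inj₁ refl , x∈) =
      contradiction (beyondRail⊆ (not σ) ℓ<s x∈) (side∉beyond σ (<⇒≤ ℓ<s))
    railStep∩afterRail σ ℓ<s (inj₂ eq   , _)  = eq

    usedEdges-unfold : ∀ σ {ℓ} → ℓ < s →
                       ｛ rail σ ℓ ｝ ∪ (RungE (suc ℓ) ∪ UsedEdges (suc ℓ)) ⊆ UsedEdges ℓ
    usedEdges-unfold σ ℓ<s (inj₁ eq)        = inj₁ (σ , _ , ≤-refl , <⇒≤ ℓ<s , eq)
    usedEdges-unfold σ ℓ<s (inj₂ (inj₁ e∈)) = inj₂ (_ , ≤-refl , ℓ<s , e∈)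
    usedEdges-unfold σ ℓ<s (inj₂ (inj₂ (inj₁ (σ′ , ℓ′ , ℓ<ℓ′ , ℓ′≤s , eq)))) =
      inj₁ (σ′ , ℓ′ , <⇒≤ ℓ<ℓ′ , ℓ′≤s , eq)
    usedEdges-unfold σ ℓ<s (inj₂ (inj₂ (inj₂ (ℓ′ , ℓ+1<ℓ′ , ℓ′≤s , e∈)))) =
      inj₂ (ℓ′ , <-trans (n<1+n _) ℓ+1<ℓ′ , ℓ′≤s , e∈)

    rail∩laterEdges : ∀ σ {ℓ} → ℓ < s → ｛ rail σ ℓ ｝ ∩ (RungE (suc ℓ) ∪ UsedEdges (suc ℓ)) ⊆ ∅
    rail∩laterEdges σ ℓ<s (refl , inj₁ e∈) = rail∉rung σ (<⇒≤ ℓ<s) ℓ<s e∈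
    rail∩laterEdges σ ℓ<s (refl , inj₂ (inj₁ (_ , ℓ′ , ℓ<ℓ′ , ℓ′≤s , eq))) =
      <⇒≢ ℓ<ℓ′ (rail-injective (<⇒≤ ℓ<s) ℓ′≤s (sym eq))
    rail∩laterEdges σ ℓ<s (refl , inj₂ (inj₂ (ℓ′ , _ , ℓ′≤s , e∈))) = rail∉rung σ (<⇒≤ ℓ<s) ℓ′≤s e∈

    zigzag-last : ∀ σ → PathThrough (side σ s) top (Reachable s σ) (UsedEdges s)
    zigzag-last σ =
      reshape (Sum.map₂ inj₁ , reachable⊆) (λ eq → inj₁ (σ , s , ≤-refl , ≤-refl , eq))
        (edgePath side≢top (proj₁ adjacent) (subst (_∈ₑ rail σ s) (side-top σ) (proj₂ adjacent)))
      where
      adjacent = rail-adjacent σ ≤-refl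
      side≢top : side σ s ≢ top
      side≢top eq = side∉beyond σ ≤-refl (inj₁ (sym eq))
      reachable⊆ : Reachable s σ ⊆ ｛ side σ s ｝ ∪ ｛ top ｝
      reachable⊆ (inj₁ eq)           = inj₁ eq
      reachable⊆ (inj₂ (inj₁ eq))    = inj₂ eq
      reachable⊆ (inj₂ (inj₂ above)) = contradiction above rungsAbove-last

    zigzag-step : ∀ σ {ℓ} → ℓ < s →
                  PathThrough (side (not σ) (suc ℓ)) top (Reachable (suc ℓ) (not σ)) (UsedEdges (suc ℓ)) →
                  PathThrough (side σ ℓ) top (Reachable ℓ σ) (UsedEdges ℓ)
    zigzag-step σ {ℓ} ℓ<s rest =
      reshape (reachable-unfold σ ℓ<s) (usedEdges-unfold σ ℓ<s)
        (join (edgePath side≢next (proj₁ adjacent) (proj₂ adjacent))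
              (join (rungFrom σ ℓ<s) rest (rung∩reachable (not σ) ℓ<s) (rung∩usedEdges ℓ<s))
              (railStep∩afterRail σ ℓ<s) (rail∩laterEdges σ ℓ<s))
      where
      adjacent = rail-adjacent σ (<⇒≤ ℓ<s)
      side≢next : side σ ℓ ≢ side σ (suc ℓ)
      side≢next eq = side∉beyond σ (<⇒≤ ℓ<s)
        (inj₂ (suc ℓ , ≤-refl , ℓ<s , subst (RungV (suc ℓ)) (sym eq) (side∈rung σ ℓ<s)))

    zigzag : ∀ d {ℓ} → d + ℓ ≡ s → ∀ σ → PathThrough (side σ ℓ) top (Reachable ℓ σ) (UsedEdges ℓ)
    zigzag zero    refl    σ = zigzag-last σ
    zigzag (suc d) {ℓ} d+ℓ≡s σ =
      zigzag-step σ (subst (ℓ <_) d+ℓ≡s (s≤s (m≤n+m ℓ d))) (zigzag d (trans (+-suc d ℓ) d+ℓ≡s) (not σ))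

    zigzagFromBottom : ∀ σ → PathThrough (side σ 0) top (Reachable 0 σ) (UsedEdges 0)
    zigzagFromBottom = zigzag s (+-identityʳ s)

    rungThenZigzag : PathThrough (side true 0) top (RungV 0 ∪ Reachable 0 false) (RungE 0 ∪ UsedEdges 0)
    rungThenZigzag = join (rung z≤n) (zigzagFromBottom false) (rung∩reachable false z≤n) (rung∩usedEdges z≤n)

module CyclePositions (s : ℕ) where

  N : ℕ
  N = suc s + suc s

  mirror : ℕ → ℕ
  mirror j = N ∸ j

  mirror-suc : ∀ {j} → j ≤ s + suc s → mirror j ≡ suc (mirror (suc j))
  mirror-suc j≤ = +-∸-assoc 1 j≤

  mirror-s : mirror s ≡ suc (suc s)
  mirror-s = trans (cong (_∸ s) (sym (+-suc s (suc s)))) (m+n∸m≡n s (suc (suc s)))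

  mirror≥ : ∀ {j} → j ≤ s → suc (suc s) ≤ mirror j
  mirror≥ {j} j≤s = subst (_≤ mirror j) mirror-s (∸-monoʳ-≤ N j≤s)


  mirror-injective : ∀ {j j′} → j ≤ s → j′ ≤ s → mirror j ≡ mirror j′ → j ≡ j′
  mirror-injective j≤s j′≤s = ∸-cancelˡ-≡ (≤-trans j≤s s≤N) (≤-trans j′≤s s≤N)
    where s≤N = ≤-trans (n≤1+n s) (m≤m+n (suc s) (suc s))

  -- On the cycle (u, v₁, …, v_N) with N = 2t, t = s + 1, side true climbs v₁, v₂, …, v_{t+1}
  -- and side false climbs u, v_N, v_{N-1}, …, v_{t+1}; railPos σ ℓ is the position of the
  -- cycle edge from level ℓ to level ℓ + 1 of side σ.
  pos : Bool → ℕ → ℕ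
  pos true  ℓ       = suc ℓ
  pos false zero    = zero
  pos false (suc j) = mirror j

  railPos : Bool → ℕ → ℕ
  railPos true  ℓ = suc ℓ
  railPos false ℓ = mirror ℓ

  pos-top : ∀ σ → pos σ (suc s) ≡ suc (suc s)
  pos-top true  = refl
  pos-top false = mirror-s

  pos≤N : ∀ σ {ℓ} → ℓ ≤ suc s → pos σ ℓ ≤ N
  pos≤N true  ℓ≤1+s       = s≤s (≤-trans ℓ≤1+s (m≤n+m (suc s) s))
  pos≤N false {zero}  _   = z≤n
  pos≤N false {suc j} _   = m∸n≤m N j

  railPos≤N : ∀ σ {ℓ} → ℓ ≤ s → railPos σ ℓ ≤ N
  railPos≤N true  ℓ≤s = pos≤N true (m≤n⇒m≤1+n ℓ≤s)
  railPos≤N false {ℓ} _ = m∸n≤m N ℓ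

  private
    suc≢mirror : ∀ {ℓ j} → ℓ ≤ s → j ≤ s → suc ℓ ≢ mirror j
    suc≢mirror ℓ≤s j≤s eq = <⇒≱ (subst (suc (suc s) ≤_) (sym eq) (mirror≥ j≤s)) (s≤s ℓ≤s)

    zero≢mirror : ∀ {j} → j ≤ s → zero ≢ mirror j
    zero≢mirror j≤s eq with subst (suc (suc s) ≤_) (sym eq) (mirror≥ j≤s)
    ... | ()

  pos-injective : ∀ σ σ′ {ℓ ℓ′} → ℓ ≤ s → ℓ′ ≤ s → pos σ ℓ ≡ pos σ′ ℓ′ → ℓ ≡ ℓ′
  pos-injective true  true                  _   _    eq = suc-injective eq
  pos-injective true  false {ℓ′ = suc _}    ℓ≤s ℓ′≤s eq = contradiction eq (suc≢mirror ℓ≤s (<⇒≤ ℓ′≤s))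
  pos-injective false true  {suc _}         ℓ≤s ℓ′≤s eq = contradiction (sym eq) (suc≢mirror ℓ′≤s (<⇒≤ ℓ≤s))
  pos-injective false false {zero}  {zero}  _   _    _  = refl
  pos-injective false false {zero}  {suc _} _   ℓ′≤s eq = contradiction eq (zero≢mirror (<⇒≤ ℓ′≤s))
  pos-injective false false {suc _} {zero}  ℓ≤s _    eq = contradiction (sym eq) (zero≢mirror (<⇒≤ ℓ≤s))
  pos-injective false false {suc _} {suc _} ℓ≤s ℓ′≤s eq =
    cong suc (mirror-injective (<⇒≤ ℓ≤s) (<⇒≤ ℓ′≤s) eq)

  pos≢top : ∀ σ {ℓ} → ℓ ≤ s → pos σ ℓ ≢ suc (suc s)
  pos≢top true          ℓ≤s eq = <⇒≱ (s≤s ℓ≤s) (≤-reflexive (sym (suc-injective eq)))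
  pos≢top false {suc _} j<s eq = <⇒≢ j<s (mirror-injective (<⇒≤ j<s) ≤-refl (trans eq (sym mirror-s)))

  railPos-injective : ∀ σ σ′ {ℓ ℓ′} → ℓ ≤ s → ℓ′ ≤ s → railPos σ ℓ ≡ railPos σ′ ℓ′ → ℓ ≡ ℓ′
  railPos-injective true  true  _   _    eq = suc-injective eq
  railPos-injective true  false ℓ≤s ℓ′≤s eq = contradiction eq (suc≢mirror ℓ≤s ℓ′≤s)
  railPos-injective false true  ℓ≤s ℓ′≤s eq = contradiction (sym eq) (suc≢mirror ℓ′≤s ℓ≤s)
  railPos-injective false false ℓ≤s ℓ′≤s eq = mirror-injective ℓ≤s ℓ′≤s eq

  railPos≢0 : ∀ σ {ℓ} → ℓ ≤ s → railPos σ ℓ ≢ zero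
  railPos≢0 true  _   ()
  railPos≢0 false ℓ≤s eq = zero≢mirror ℓ≤s (sym eq)

  pos-surjective : ∀ {n} → n ≤ N → ∃₂ λ σ ℓ → ℓ ≤ suc s × pos σ ℓ ≡ n
  pos-surjective {zero}  _ = false , zero , z≤n , refl
  pos-surjective {suc m} n≤N with m ≤? s
  ... | yes m≤s = true , m , m≤n⇒m≤1+n m≤s , refl
  ... | no  m≰s = false , suc (mirror (suc m)) , s≤s mirror≤s , m∸[m∸n]≡n n≤N
    where
    mirror≤s : mirror (suc m) ≤ s
    mirror≤s = subst (mirror (suc m) ≤_) (m+n∸n≡m s (suc s)) (∸-monoʳ-≤ N (s≤s (≰⇒> m≰s)))

module AbsorberLadder
  (H : Hypergraph) (u : Hypergraph.V H) (s : ℕ)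
  (C : BergeCycle H (suc s + suc s)) (C-u : BergeCycle.w C zero ≡ u)
  (P : Fin s → BergePath H)
  (P-ends : (j : Fin s) →
      (BergePath.start (P j) ≡ at H C (suc (suc (toℕ j)))
         × BergePath.end (P j) ≡ at H C ((suc s + suc s) ∸ toℕ j))
    ⊎ (BergePath.start (P j) ≡ at H C ((suc s + suc s) ∸ toℕ j)
         × BergePath.end (P j) ≡ at H C (suc (suc (toℕ j)))))
  (P-inner-disj : (j j′ : Fin s) → j ≢ j′ → (x : Hypergraph.V H) →
      BergePath.Interior (P j) x → ¬ BergePath.Interior (P j′) x)
  (P-inner-C : (j : Fin s) (x : Hypergraph.V H) → BergePath.Interior (P j) x → ¬ BergeCycle.InV C x)
  (E-disj-C : (j : Fin s) (e : Hypergraph.E H) → BergePath.InE (P j) e → ¬ BergeCycle.InE C e)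
  (E-disj-P : (j j′ : Fin s) → j ≢ j′ → (e : Hypergraph.E H) →
      BergePath.InE (P j) e → ¬ BergePath.InE (P j′) e)
  where

  open Hypergraph H
  open CyclePositions s

  vertex : ℕ → V
  vertex = at H C

  edge : ℕ → E
  edge = atₑ H C

  side : Bool → ℕ → V
  side σ ℓ = vertex (pos σ ℓ)

  top : V
  top = vertex (suc (suc s))

  side≤N : ∀ σ {ℓ} → ℓ ≤ s → pos σ ℓ ≤ N
  side≤N σ ℓ≤s = pos≤N σ (m≤n⇒m≤1+n ℓ≤s)

  -- Rung ℓ ≥ 1 is the path P_ℓ, which the absorber indexes by ℓ - 1 : Fin s.
  RungV : ℕ → Pred V 0ℓ
  RungV zero    = ｛ vertex 1 ｝ ∪ ｛ vertex 0 ｝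
  RungV (suc j) x = ∃ λ i → toℕ i ≡ j × BergePath.InV (P i) x

  RungE : ℕ → Pred E 0ℓ
  RungE zero    = ｛ edge 0 ｝
  RungE (suc j) e = ∃ λ i → toℕ i ≡ j × BergePath.InE (P i) e

  pathAlong : (i : Fin s) → PathThrough H (vertex (suc (suc (toℕ i)))) (vertex (mirror (toℕ i)))
                                          (BergePath.InV (P i)) (BergePath.InE (P i))
  pathAlong i with P-ends i
  ... | inj₁ (start≡ , end≡) = retarget H start≡ end≡ (fromBergePath H (P i))
  ... | inj₂ (start≡ , end≡) = retarget H end≡ start≡ (reverse H (fromBergePath H (P i)))

  rung : ∀ {ℓ} → ℓ ≤ s → PathThrough H (side true ℓ) (side false ℓ) (RungV ℓ) (RungE ℓ)
  rung {zero} _ = edgePath H 1≢0 (proj₂ adjacent) (proj₁ adjacent)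
    where
    adjacent = atₑ-adjacent H C (s≤s z≤n)
    1≢0 : vertex 1 ≢ vertex 0
    1≢0 eq with at-injective H C (side≤N true z≤n) z≤n eq
    ... | ()
  rung {suc j} j<s = reshape H (RungV⊆ , ⊆RungV) (λ e∈ → i , i≡j , e∈)
      (retarget H (cong (λ k → vertex (suc (suc k))) i≡j) (cong (vertex ∘ mirror) i≡j) (pathAlong i))
    where
    i = fromℕ< j<s
    i≡j = toℕ-fromℕ< j<s
    RungV⊆ : BergePath.InV (P i) ⊆ RungV (suc j)
    RungV⊆ x∈ = i , i≡j , x∈
    ⊆RungV : RungV (suc j) ⊆ BergePath.InV (P i)
    ⊆RungV (i′ , i′≡j , x∈) = subst (λ k → BergePath.InV (P k) _) (toℕ-injective (trans i′≡j (sym i≡j))) x∈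

  side∈cycle : ∀ σ {ℓ} → ℓ ≤ s → BergeCycle.InV C (side σ ℓ)
  side∈cycle σ ℓ≤s = at∈cycle H C (side≤N σ ℓ≤s)

  side-injective : ∀ σ σ′ {ℓ ℓ′} → ℓ ≤ s → ℓ′ ≤ s → side σ ℓ ≡ side σ′ ℓ′ → ℓ ≡ ℓ′
  side-injective σ σ′ ℓ≤s ℓ′≤s eq =
    pos-injective σ σ′ ℓ≤s ℓ′≤s (at-injective H C (side≤N σ ℓ≤s) (side≤N σ′ ℓ′≤s) eq)

  rungV-classify : ∀ {ℓ x} → x ∈ RungV ℓ →
    (∃ λ σ → side σ ℓ ≡ x) ⊎ (∃ λ i → suc (toℕ i) ≡ ℓ × BergePath.Interior (P i) x)
  rungV-classify {zero} (inj₁ eq) = inj₁ (true , eq)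
  rungV-classify {zero} (inj₂ eq) = inj₁ (false , eq)
  rungV-classify {suc _} (i , refl , x∈) with endpoint⊎interior H (P i) x∈ | P-ends i
  ... | inj₁ refl          | inj₁ (start≡ , _) = inj₁ (true  , sym start≡)
  ... | inj₁ refl          | inj₂ (start≡ , _) = inj₁ (false , sym start≡)
  ... | inj₂ (inj₁ refl)   | inj₁ (_ , end≡)   = inj₁ (false , sym end≡)
  ... | inj₂ (inj₁ refl)   | inj₂ (_ , end≡)   = inj₁ (true  , sym end≡)
  ... | inj₂ (inj₂ inner)  | _                 = inj₂ (i , refl , inner)

  rungV-disjoint : ∀ {ℓ ℓ′} → ℓ ≤ s → ℓ′ ≤ s → ℓ ≢ ℓ′ → RungV ℓ ∩ RungV ℓ′ ⊆ ∅
  rungV-disjoint {ℓ} {ℓ′} ℓ≤s ℓ′≤s ℓ≢ℓ′ (x∈ , x∈′)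
    with rungV-classify {ℓ} x∈ | rungV-classify {ℓ′} x∈′
  ... | inj₁ (σ , refl)       | inj₁ (σ′ , eq)          = ℓ≢ℓ′ (side-injective σ σ′ ℓ≤s ℓ′≤s (sym eq))
  ... | inj₁ (σ , refl)       | inj₂ (i , _ , inner)    = P-inner-C i _ inner (side∈cycle σ ℓ≤s)
  ... | inj₂ (i , _ , inner)  | inj₁ (σ , refl)         = P-inner-C i _ inner (side∈cycle σ ℓ′≤s)
  ... | inj₂ (i , refl , inner) | inj₂ (i′ , refl , inner′) =
    P-inner-disj i i′ (λ i≡i′ → ℓ≢ℓ′ (cong (suc ∘ toℕ) i≡i′)) _ inner inner′

  top∈cycle : BergeCycle.InV C top
  top∈cycle = at∈cycle H C (pos≤N true ≤-refl)

  top∉rung : ∀ {ℓ} → ℓ ≤ s → top ∉ RungV ℓ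
  top∉rung {ℓ} ℓ≤s top∈ with rungV-classify {ℓ} top∈
  ... | inj₁ (σ , eq) = pos≢top σ ℓ≤s (at-injective H C (side≤N σ ℓ≤s) (pos≤N true ≤-refl) eq)
  ... | inj₂ (i , _ , inner) = P-inner-C i _ inner top∈cycle

  rail : Bool → ℕ → E
  rail σ ℓ = edge (railPos σ ℓ)

  rail-adjacent : ∀ σ {ℓ} → ℓ ≤ s → side σ ℓ ∈ₑ rail σ ℓ × side σ (suc ℓ) ∈ₑ rail σ ℓ
  rail-adjacent true  ℓ≤s = atₑ-adjacent H C (pos≤N true (s≤s ℓ≤s))
  rail-adjacent false {zero} _ = swap (atₑ-adjacent-last H C)
  rail-adjacent false {suc ℓ} ℓ<s =
      subst (λ n → vertex n ∈ₑ rail false (suc ℓ)) (sym mirror≡) (proj₂ adjacent) , proj₁ adjacent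
    where
    mirror≡ = mirror-suc (≤-trans (<⇒≤ ℓ<s) (m≤m+n s (suc s)))
    adjacent = atₑ-adjacent H C (subst (_≤ N) mirror≡ (m∸n≤m N ℓ))

  rail∈cycle : ∀ σ {ℓ} → ℓ ≤ s → BergeCycle.InE C (rail σ ℓ)
  rail∈cycle σ ℓ≤s = atₑ∈cycle H C (railPos≤N σ ℓ≤s)

  rail-injective : ∀ {σ σ′ ℓ ℓ′} → ℓ ≤ s → ℓ′ ≤ s → rail σ ℓ ≡ rail σ′ ℓ′ → ℓ ≡ ℓ′
  rail-injective {σ} {σ′} ℓ≤s ℓ′≤s eq =
    railPos-injective σ σ′ ℓ≤s ℓ′≤s (atₑ-injective H C (railPos≤N σ ℓ≤s) (railPos≤N σ′ ℓ′≤s) eq)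

  edge0∈cycle : BergeCycle.InE C (edge 0)
  edge0∈cycle = atₑ∈cycle H C z≤n

  rail∉rung : ∀ σ {ℓ ℓ′} → ℓ ≤ s → ℓ′ ≤ s → rail σ ℓ ∉ RungE ℓ′
  rail∉rung σ {ℓ′ = zero}  ℓ≤s _ eq =
    railPos≢0 σ ℓ≤s (atₑ-injective H C (railPos≤N σ ℓ≤s) z≤n (sym eq))
  rail∉rung σ {ℓ′ = suc _} ℓ≤s _ (i , _ , e∈) = E-disj-C i _ e∈ (rail∈cycle σ ℓ≤s)

  rungE-disjoint : ∀ {ℓ ℓ′} → ℓ ≤ s → ℓ′ ≤ s → ℓ ≢ ℓ′ → RungE ℓ ∩ RungE ℓ′ ⊆ ∅
  rungE-disjoint {zero}  {zero}  _ _ ℓ≢ℓ′ _                       = ℓ≢ℓ′ refl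
  rungE-disjoint {zero}  {suc _} _ _ _    (refl , i , _ , e∈)     = E-disj-C i _ e∈ edge0∈cycle
  rungE-disjoint {suc _} {zero}  _ _ _    ((i , _ , e∈) , refl)   = E-disj-C i _ e∈ edge0∈cycle
  rungE-disjoint {suc _} {suc _} _ _ ℓ≢ℓ′ ((i , refl , e∈) , (i′ , refl , e∈′)) =
    E-disj-P i i′ (λ i≡i′ → ℓ≢ℓ′ (cong (suc ∘ toℕ) i≡i′)) _ e∈ e∈′

  ladder : Ladder H s
  ladder = record
    { side           = side
    ; top            = top
    ; side-top       = cong vertex ∘ pos-top
    ; rail           = rail
    ; rail-adjacent  = rail-adjacent
    ; RungV          = RungV
    ; RungE          = RungE
    ; rung           = rung
    ; rungV-disjoint = rungV-disjoint
    ; top∉rung       = top∉rung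
    ; rail-injective = λ {σ} {σ′} → rail-injective {σ} {σ′}
    ; rail∉rung      = rail∉rung
    ; rungE-disjoint = rungE-disjoint
    }

  OnPaths : Pred V 0ℓ
  OnPaths x = ∃ λ j → BergePath.InV (P j) x

  AbsorberEdges : Pred E 0ℓ
  AbsorberEdges e = BergeCycle.InE C e ⊎ ∃ λ j → BergePath.InE (P j) e

  rungsAbove0⇒onPaths : RungsAbove H ladder 0 ⊆ OnPaths
  rungsAbove0⇒onPaths (suc _ , _ , _ , i , _ , x∈) = i , x∈

  onPaths⇒rungsAbove0 : OnPaths ⊆ RungsAbove H ladder 0
  onPaths⇒rungsAbove0 (i , x∈) = suc (toℕ i) , s≤s z≤n , toℕ<n i , i , refl , x∈

  cycle⇒rungs : BergeCycle.InV C ⊆ RungV 0 ∪ ｛ top ｝ ∪ RungsAbove H ladder 0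
  cycle⇒rungs x∈ with cycle⇒at H C x∈
  ... | n , n≤N , refl with pos-surjective n≤N
  ... | σ , ℓ , ℓ≤1+s , refl with m≤n⇒m<n∨m≡n ℓ≤1+s
  ... | inj₂ refl = inj₂ (inj₁ (cong vertex (sym (pos-top σ))))
  ... | inj₁ (s≤s ℓ≤s) = rung⊆ ℓ≤s (side∈rung H ladder σ ℓ≤s)
    where
    rung⊆ : ∀ {ℓ} → ℓ ≤ s → RungV ℓ ⊆ RungV 0 ∪ ｛ top ｝ ∪ RungsAbove H ladder 0
    rung⊆ {zero}  _   x∈ = inj₁ x∈
    rung⊆ {suc _} ℓ≤s x∈ = inj₂ (inj₂ (_ , s≤s z≤n , ℓ≤s , x∈))

  usedEdges⊆absorber : UsedEdges H ladder 0 ⊆ AbsorberEdges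
  usedEdges⊆absorber (inj₁ (σ , ℓ , _ , ℓ≤s , refl))      = inj₁ (rail∈cycle σ ℓ≤s)
  usedEdges⊆absorber (inj₂ (suc _ , _ , _ , i , _ , e∈)) = inj₂ (i , e∈)

  vertex0≡u : vertex 0 ≡ u
  vertex0≡u = trans (at-≡ H C refl) C-u

  vertex≢u : ∀ {n} → n ≤ N → n ≢ 0 → vertex n ≢ u
  vertex≢u n≤N n≢0 eq = n≢0 (at-injective H C n≤N z≤n (trans eq (sym vertex0≡u)))

  pathThroughAll : BergePathThrough H (vertex 1) top (BergeCycle.InV C ∪ OnPaths) AbsorberEdges
  pathThroughAll = toBergePath H (reshape H (⊆all , all⊆) edges⊆ (rungThenZigzag H ladder))
    where
    ⊆all : RungV 0 ∪ Reachable H ladder 0 false ⊆ BergeCycle.InV C ∪ OnPaths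
    ⊆all (inj₁ (inj₁ refl))        = inj₁ (at∈cycle H C (side≤N true z≤n))
    ⊆all (inj₁ (inj₂ refl))        = inj₁ (at∈cycle H C z≤n)
    ⊆all (inj₂ (inj₁ refl))        = inj₁ (at∈cycle H C z≤n)
    ⊆all (inj₂ (inj₂ (inj₁ refl))) = inj₁ top∈cycle
    ⊆all (inj₂ (inj₂ (inj₂ x∈)))   = inj₂ (rungsAbove0⇒onPaths x∈)
    all⊆ : BergeCycle.InV C ∪ OnPaths ⊆ RungV 0 ∪ Reachable H ladder 0 false
    all⊆ (inj₁ x∈) = Sum.map₂ inj₂ (cycle⇒rungs x∈)
    all⊆ (inj₂ x∈) = inj₂ (inj₂ (inj₂ (onPaths⇒rungsAbove0 x∈)))
    edges⊆ : RungE 0 ∪ UsedEdges H ladder 0 ⊆ AbsorberEdges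
    edges⊆ (inj₁ refl) = inj₁ edge0∈cycle
    edges⊆ (inj₂ e∈)   = usedEdges⊆absorber e∈

  pathAvoidingU : BergePathThrough H (vertex 1) top (λ x → (BergeCycle.InV C x × x ≢ u) ⊎ OnPaths x) AbsorberEdges
  pathAvoidingU = toBergePath H (reshape H (⊆all , all⊆) usedEdges⊆absorber (zigzagFromBottom H ladder true))
    where
    ⊆all : Reachable H ladder 0 true ⊆ (λ x → (BergeCycle.InV C x × x ≢ u) ⊎ OnPaths x)
    ⊆all (inj₁ refl)        = inj₁ (at∈cycle H C (side≤N true z≤n) , vertex≢u (side≤N true z≤n) λ ())
    ⊆all (inj₂ (inj₁ refl)) = inj₁ (top∈cycle , vertex≢u (pos≤N true ≤-refl) λ ())
    ⊆all (inj₂ (inj₂ x∈))   = inj₂ (rungsAbove0⇒onPaths x∈)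
    all⊆ : (λ x → (BergeCycle.InV C x × x ≢ u) ⊎ OnPaths x) ⊆ Reachable H ladder 0 true
    all⊆ (inj₂ x∈) = inj₂ (inj₂ (onPaths⇒rungsAbove0 x∈))
    all⊆ (inj₁ (x∈ , x≢u)) with cycle⇒rungs x∈
    ... | inj₁ (inj₁ eq)   = inj₁ eq
    ... | inj₁ (inj₂ refl) = contradiction vertex0≡u x≢u
    ... | inj₂ x∈′         = inj₂ x∈′

proposition4p2 : (H : Hypergraph) → (u : Hypergraph.V H) → (A : Absorber H u) →
    (Σ (BergePath H) λ Pu →
        ContainedIn H A Pu
      × BergePath.start Pu ≡ Absorber.v₁ A
      × BergePath.end Pu ≡ Absorber.vt+1 A
      × ((x : Hypergraph.V H) → BergePath.InV Pu x ⇔ Absorber.InVAll A x))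
    × (Σ (BergePath H) λ P →
        ContainedIn H A P
      × BergePath.start P ≡ Absorber.v₁ A
      × BergePath.end P ≡ Absorber.vt+1 A
      × ((x : Hypergraph.V H) → BergePath.InV P x ⇔
           ((BergeCycle.InV (Absorber.C A) x × x ≢ u)
             ⊎ ∃ λ j → BergePath.InV (Absorber.P A j) x)))
proposition4p2 H u record
  { t = suc s ; t≥1 = s≤s z≤n ; C = C ; C-u = C-u ; P = P ; P-ends = P-ends
  ; P-inner-disj = P-inner-disj ; P-inner-C = P-inner-C ; E-disj-C = E-disj-C ; E-disj-P = E-disj-P } =
  pathThroughAll , pathAvoidingU
  where open AbsorberLadder H u s C C-u P P-ends P-inner-disj P-inner-C E-disj-C E-disj-P
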